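{- Let $\mathcal{H}=(\mathcal{U},\mathcal{E})$ be a finite dihypergraph and let $\mathcal{U}_1,\dots,\mathcal{U}_k$ be the vertex sets of the H-factors (leaves) of an H-decomposition of $\mathcal{H}$ into H-factors. Then $\mathcal{F}_{\mathcal{H}}$ is a meet-sublattice of the direct product $\mathcal{F}_{\mathcal{H}[\mathcal{U}_1]}\times\cdots\times\mathcal{F}_{\mathcal{H}[\mathcal{U}_k]}$; that is, $\mathcal{F}_{\mathcal{H}}\subseteq\{F_1\cup\dots\cup F_k: F_j\in\mathcal{F}_{\mathcal{H}[\mathcal{U}_j]}\}$ and $\mathcal{F}_{\mathcal{H}}$ is closed under intersection.
   Context: A dihypergraph $\mathcal{H}=(\mathcal{U},\mathcal{E})$ consists of a finite vertex set $\mathcal{U}$ and a finite set $\mathcal{E}$ of edges; each edge is a pair $(B,h)$ with $B\subseteq\mathcal{U}$ and $h\in\mathcal{U}\setminus B$; an edge is identified with $B\cup\{h\}$ for containment. For $U\subseteq\mathcal{U}$, $\mathcal{H}[U]=(U,\{e\in\mathcal{E}: e\subseteq U\})$. A body-path is a sequence $v_1,e_1,\dots,v_m,e_m,v_{m+1}$ ($m\ge0$) of distinct vertices and distinct edges $e_i=(B_i,h_i)$ with $\{v_i,v_{i+1}\}\subseteq B_i$; a dihypergraph is body-connected if every two vertices are joined by a body-path, and a body-connected component is a maximal vertex subset any two of whose elements are joined by a body-path. An H-decomposition into H-factors is obtained recursively: if the current dihypergraph $\mathcal{G}$ has one vertex or is body-connected, it is a leaf (an H-factor) with vertex set $V(\mathcal{G})$;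 otherwise choose a body-connected component $C$ of $\mathcal{G}$ and recursively decompose $\mathcal{G}[C]$ and $\mathcal{G}[V(\mathcal{G})\setminus C]$. The vertex sets of the leaves partition $\mathcal{U}$. The closure system of a dihypergraph $\mathcal{G}=(V,\mathcal{E}')$ is $\mathcal{F}_{\mathcal{G}}=\{F\subseteq V:\text{for every }(B,h)\in\mathcal{E}',\ B\subseteq F\Rightarrow h\in F\}$. The product of families is $\mathcal{F}_1\times\cdots\times\mathcal{F}_k=\{F_1\cup\dots\cup F_k: F_j\in\mathcal{F}_j\}$. -}

module Defs where

open import Data.Nat using (ℕ)
open import Data.Fin using (Fin)
open import Data.Fin.Subset
  using (Subset; _∈_; _∉_; _⊆_; _∩_; _∪_; _─_; ⋃; ∣_∣; ⁅_⁆; ⊤)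
open import Data.List using (List; []; _∷_; [_]; _++_)
open import Data.List.Relation.Unary.All using (All)
open import Data.List.Relation.Unary.Unique.Propositional using (Unique)
open import Data.List.Relation.Binary.Pointwise using (Pointwise)
import Data.List.Membership.Propositional as L
open import Data.Product using (_×_; _,_; proj₁; proj₂; ∃; ∃-syntax; Σ-syntax)
open import Relation.Binary.PropositionalEquality using (_≡_)
open import Relation.Nullary using (¬_)

Edge : ℕ → Set
Edge n = Subset n × Fin n

body : ∀ {n} → Edge n → Subset n
body = proj₁

head : ∀ {n} → Edge n → Fin n
head = proj₂

-- The edge identified with B ∪ {h} for containment.
edgeSet : ∀ {n} → Edge n → Subset n
edgeSet (B , h) = B ∪ ⁅ h ⁆

record Dihypergraph (n : ℕ) : Set where
  field
    edges      : List (Edge n)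
    edgesUniq  : Unique edges
    headNotInB : All (λ e → head e ∉ body e) edges

open Dihypergraph public

module _ {n : ℕ} (H : Dihypergraph n) where

  -- e is an edge of the induced dihypergraph H[U]
  EdgeOf : Subset n → Edge n → Set
  EdgeOf U e = (e L.∈ edges H) × (edgeSet e ⊆ U)

  data Walk (U : Subset n) : Fin n → Fin n → List (Fin n) → List (Edge n) → Set where
    stop : ∀ {v} → v ∈ U → Walk U v v [ v ] []
    step : ∀ {v w u vs es} (e : Edge n) → EdgeOf U e →
           v ∈ body e → w ∈ body e →
           Walk U w u vs es → Walk U v u (v ∷ vs) (e ∷ es)

  BodyPath : Subset n → Fin n → Fin n → Set
  BodyPath U v u =
    ∃[ vs ] ∃[ es ] (Walk U v u vs es × Unique vs × Unique es)

  Joined : Subset n → Subset n → Set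
  Joined U C = ∀ {v u} → v ∈ C → u ∈ C → BodyPath U v u

  BodyConnected : Subset n → Set
  BodyConnected U = Joined U U

  Component : Subset n → Subset n → Set
  Component U C =
    C ⊆ U × Joined U C × (∀ D → C ⊆ D → D ⊆ U → Joined U D → D ⊆ C)

  -- HDecomp U Ls : Ls is the list of vertex sets of the leaves (H-factors)
  -- of an H-decomposition of H[U].
  data HDecomp : Subset n → List (Subset n) → Set where
    leafOne  : ∀ {U} → ∣ U ∣ ≡ 1 → HDecomp U [ U ]
    leafConn : ∀ {U} → BodyConnected U → HDecomp U [ U ]
    split    : ∀ {U C Ls₁ Ls₂} →
               ¬ (∣ U ∣ ≡ 1) → ¬ BodyConnected U →
               Component U C →
               HDecomp C Ls₁ → HDecomp (U ─ C) Ls₂ →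
               HDecomp U (Ls₁ ++ Ls₂)

  ClosedIn : Subset n → Subset n → Set
  ClosedIn U F =
    F ⊆ U × (∀ e → EdgeOf U e → body e ⊆ F → head e ∈ F)

  Closed : Subset n → Set
  Closed = ClosedIn ⊤

  InProduct : List (Subset n) → Subset n → Set
  InProduct Us F =
    ∃[ Fs ] (Pointwise (λ Uj Fj → ClosedIn Uj Fj) Us Fs × F ≡ ⋃ Fs)

module Submission where

-- Every edge of H[C] (C ⊆ U) and of H[U ─ C] is an edge of H[U], so a closed
-- set F of H[U] leaves closed traces F ∩ C and F ─ C on both sides of a split.  Induction on
-- the decomposition then writes F as the union of its closed traces on the leaves.

open import Defs
open import Data.Nat using (ℕ)
open import Data.Fin using (Fin)
open import Data.Fin.Subset
  using (Subset; _∈_; _∉_; _⊆_; _∩_; _∪_; _─_; ⋃; ⊤; inside; outside)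
open import Data.Fin.Subset.Properties
open import Data.Vec using ([]; _∷_; here; there)
open import Data.List using (List; []; _∷_; _++_)
open import Data.List.Relation.Binary.Pointwise as Pointwise using ()
open import Data.Product using (_×_; _,_; proj₂)
open import Data.Sum using (inj₂)
open import Relation.Binary.PropositionalEquality
  using (_≡_; refl; sym; cong; subst; cong₂; module ≡-Reasoning)

x∈p─q⇒x∉q : ∀ {n} {x : Fin n} (p q : Subset n) → x ∈ p ─ q → x ∉ q
x∈p─q⇒x∉q (inside ∷ p) (outside ∷ q) here      ()
x∈p─q⇒x∉q (_      ∷ p) (_       ∷ q) (there x∈) (there x∈q) = x∈p─q⇒x∉q p q x∈ x∈q

p≡p∩q∪p─q : ∀ {n} (p q : Subset n) → p ≡ (p ∩ q) ∪ (p ─ q)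
p≡p∩q∪p─q []            []            = refl
p≡p∩q∪p─q (inside  ∷ p) (inside  ∷ q) = cong (inside  ∷_) (p≡p∩q∪p─q p q)
p≡p∩q∪p─q (inside  ∷ p) (outside ∷ q) = cong (inside  ∷_) (p≡p∩q∪p─q p q)
p≡p∩q∪p─q (outside ∷ p) (inside  ∷ q) = cong (outside ∷_) (p≡p∩q∪p─q p q)
p≡p∩q∪p─q (outside ∷ p) (outside ∷ q) = cong (outside ∷_) (p≡p∩q∪p─q p q)

⋃-++ : ∀ {n} (ps qs : List (Subset n)) → ⋃ (ps ++ qs) ≡ ⋃ ps ∪ ⋃ qs
⋃-++ []       qs = sym (∪-identityˡ (⋃ qs))
⋃-++ (p ∷ ps) qs = begin
  p ∪ ⋃ (ps ++ qs)     ≡⟨ cong (p ∪_) (⋃-++ ps qs) ⟩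
  p ∪ (⋃ ps ∪ ⋃ qs)    ≡⟨ sym (∪-assoc p (⋃ ps) (⋃ qs)) ⟩
  (p ∪ ⋃ ps) ∪ ⋃ qs    ∎
  where open ≡-Reasoning

head∈edgeSet : ∀ {n} (e : Edge n) → head e ∈ edgeSet e
head∈edgeSet (_ , h) = x∈p∪q⁺ (inj₂ (x∈⁅x⁆ h))

module _ {n : ℕ} (H : Dihypergraph n) where

  EdgeOf-mono : ∀ {U V e} → U ⊆ V → EdgeOf H U e → EdgeOf H V e
  EdgeOf-mono U⊆V (e∈H , e⊆U) = e∈H , λ x∈e → U⊆V (e⊆U x∈e)

  ClosedIn-∩ : ∀ {U F G} → ClosedIn H U F → ClosedIn H U G → ClosedIn H U (F ∩ G)
  ClosedIn-∩ {F = F} {G} (F⊆U , closedF) (_ , closedG) =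
    (λ x∈F∩G → F⊆U (p∩q⊆p F G x∈F∩G)) ,
    λ e e∈U B⊆F∩G →
      x∈p∩q⁺ ( closedF e e∈U (λ x∈B → p∩q⊆p F G (B⊆F∩G x∈B))
             , closedG e e∈U (λ x∈B → p∩q⊆q F G (B⊆F∩G x∈B)))

  ClosedIn-trace-⊆ : ∀ {U C F} → C ⊆ U → ClosedIn H U F → ClosedIn H C (F ∩ C)
  ClosedIn-trace-⊆ {C = C} {F} C⊆U (_ , closedF) =
    p∩q⊆q F C ,
    λ e e∈C B⊆F∩C →
      x∈p∩q⁺ ( closedF e (EdgeOf-mono C⊆U e∈C) (λ x∈B → p∩q⊆p F C (B⊆F∩C x∈B))
             , proj₂ e∈C (head∈edgeSet e))

  ClosedIn-trace-─ : ∀ {U C F} → ClosedIn H U F → ClosedIn H (U ─ C) (F ─ C)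
  ClosedIn-trace-─ {U} {C} {F} (F⊆U , closedF) =
    (λ x∈F─C → x∈p∧x∉q⇒x∈p─q (F⊆U (p─q⊆p F C x∈F─C)) (x∈p─q⇒x∉q F C x∈F─C)) ,
    λ e e∈U─C B⊆F─C →
      x∈p∧x∉q⇒x∈p─q
        (closedF e (EdgeOf-mono (p─q⊆p U C) e∈U─C) (λ x∈B → p─q⊆p F C (B⊆F─C x∈B)))
        (x∈p─q⇒x∉q U C (proj₂ e∈U─C (head∈edgeSet e)))

  InProduct-++ : ∀ {Us Vs F G} → InProduct H Us F → InProduct H Vs G →
                 InProduct H (Us ++ Vs) (F ∪ G)
  InProduct-++ {F = F} {G} (Fs , Fs-closed , F≡⋃Fs) (Gs , Gs-closed , G≡⋃Gs) =
    Fs ++ Gs , Pointwise.++⁺ Fs-closed Gs-closed , (begin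
      F ∪ G               ≡⟨ cong₂ _∪_ F≡⋃Fs G≡⋃Gs ⟩
      ⋃ Fs ∪ ⋃ Gs         ≡⟨ sym (⋃-++ Fs Gs) ⟩
      ⋃ (Fs ++ Gs)        ∎)
    where open ≡-Reasoning

  InProduct-leaf : ∀ {U F} → ClosedIn H U F → InProduct H (U ∷ []) F
  InProduct-leaf {F = F} closedF =
    F ∷ [] , closedF Pointwise.∷ Pointwise.[] , sym (∪-identityʳ F)

  HDecomp⇒InProduct : ∀ {U Us} → HDecomp H U Us → ∀ F → ClosedIn H U F → InProduct H Us F
  HDecomp⇒InProduct (leafOne  _) F closedF = InProduct-leaf closedF
  HDecomp⇒InProduct (leafConn _) F closedF = InProduct-leaf closedF
  HDecomp⇒InProduct (split {C = C} _ _ (C⊆U , _ , _) decompC decompU─C) F closedF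
    = subst (InProduct H _) (sym (p≡p∩q∪p─q F C)) (InProduct-++
        (HDecomp⇒InProduct decompC   (F ∩ C) (ClosedIn-trace-⊆ C⊆U closedF))
        (HDecomp⇒InProduct decompU─C (F ─ C) (ClosedIn-trace-─ closedF)))

corollary1 : ∀ {n} (H : Dihypergraph n) (Us : List (Subset n)) →
    HDecomp H ⊤ Us →
    (∀ F → Closed H F → InProduct H Us F) ×
    (∀ F G → Closed H F → Closed H G → Closed H (F ∩ G))
corollary1 H Us decomp =
  HDecomp⇒InProduct H decomp ,
  λ F G → ClosedIn-∩ H
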